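{- Let $p,q\ge3$ with $(p-2)(q-2)>4$, and for $k\ge1$ let $u_k$ and $w_k$ be the lengths of the words $U_k$ and $W_k$. Then for all $k\ge1$: if $p=3$ (and $q\ge7$): $u_k=\gamma_k$ and $w_k=\gamma_k-\gamma_{k-1}$; if $p,q\ge4$: $u_k=\gamma_k+\gamma_{k-1}$ and $w_k=\gamma_k-(p-3)\gamma_{k-1}$; if $q=3$ (and $p\ge7$): $u_k=\gamma_k+\gamma_{k-1}$ and $w_k=\gamma_k-\gamma_{k-2}$.
   Context: $\alpha>1$ is the root of $\alpha^2+2\alpha+1=(p-2)(q-2)\alpha$ and $\gamma_k=\frac{\alpha^k-\alpha^{ -k}}{\alpha-\alpha^{ -1}}$ for all integers $k$. Words: $x^a$ denotes $a$ consecutive copies of $x$. Define $U_k,W_k$ ($k\ge1$): if $p=3$: $U_1=3$, $W_1=4$, $U_{k+1}=W_kU_k^{q-5}$, $W_{k+1}=W_kU_k^{q-6}$; if $p\ge4,q\ge4$: $U_1=2$, $W_1=3$, $U_{k+1}=W_kU_k^{p-4}(W_kU_k^{p-3})^{q-3}$, $W_{k+1}=W_kU_k^{p-4}(W_kU_k^{p-3})^{q-4}$; if $q=3$: $U_1=2$, $W_1=32$, $U_{k+1}=W_kU_k^{p-5}$, $W_{k+1}=W_kU_k^{p-6}$. -}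

module Defs where

open import Data.Nat as ℕ using (ℕ; zero; suc; _∸_; _≡ᵇ_)
open import Data.Integer as ℤ using (ℤ; +_; -[1+_]; _-_; -_)
open import Data.List using (List; []; _∷_; _++_)
open import Data.Product using (_×_; _,_; proj₁; proj₂)
open import Data.Bool using (if_then_else_)

-- The sequence γ_k.
-- α > 1 is the root of α² + 2α + 1 = (p-2)(q-2)α, i.e. α + α⁻¹ = s
-- with s = (p-2)(q-2) - 2.  Hence γ_k = (α^k - α^{-k})/(α - α^{-1})
-- satisfies γ_0 = 0, γ_1 = 1, γ_{k+2} = s γ_{k+1} - γ_k, and
-- γ_{-k} = - γ_k.

sPar : ℕ → ℕ → ℤ
sPar p q = (+ (p ∸ 2)) ℤ.* (+ (q ∸ 2)) - + 2

γℕ : ℕ → ℕ → ℕ → ℤ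
γℕ p q zero = + 0
γℕ p q (suc zero) = + 1
γℕ p q (suc (suc k)) = sPar p q ℤ.* γℕ p q (suc k) - γℕ p q k

γ : ℕ → ℕ → ℤ → ℤ
γ p q (+ k) = γℕ p q k
γ p q -[1+ k ] = - γℕ p q (suc k)

Word : Set
Word = List ℕ

_^ʷ_ : Word → ℕ → Word
x ^ʷ zero = []
x ^ʷ suc a = x ++ (x ^ʷ a)

base : ℕ → ℕ → Word × Word
base p q =
  if p ≡ᵇ 3 then (3 ∷ [] , 4 ∷ [])
  else if q ≡ᵇ 3 then (2 ∷ [] , 3 ∷ 2 ∷ [])
  else (2 ∷ [] , 3 ∷ [])

step : ℕ → ℕ → Word × Word → Word × Word
step p q (U , W) =
  if p ≡ᵇ 3 then (W ++ (U ^ʷ (q ∸ 5)) , W ++ (U ^ʷ (q ∸ 6)))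
  else if q ≡ᵇ 3 then (W ++ (U ^ʷ (p ∸ 5)) , W ++ (U ^ʷ (p ∸ 6)))
  else ( W ++ (U ^ʷ (p ∸ 4)) ++ ((W ++ (U ^ʷ (p ∸ 3))) ^ʷ (q ∸ 3))
       , W ++ (U ^ʷ (p ∸ 4)) ++ ((W ++ (U ^ʷ (p ∸ 3))) ^ʷ (q ∸ 4)))

-- UW p q k = (U_k , W_k) for k ≥ 1 (the value at k = 0 is unused).
UW : ℕ → ℕ → ℕ → Word × Word
UW p q zero = ([] , [])
UW p q (suc zero) = base p q
UW p q (suc (suc k)) = step p q (UW p q (suc k))

U : ℕ → ℕ → ℕ → Word
U p q k = proj₁ (UW p q k)

W : ℕ → ℕ → ℕ → Word
W p q k = proj₂ (UW p q k)

{-# OPTIONS --safe #-}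
-- The lengths of (U_k, W_k) evolve by a linear map of ℤ², and in each of the
-- three cases that map is conjugate, via the claimed closed form, to the shift
-- (γ_{k-1}, γ_k) ↦ (γ_k, s γ_k - γ_{k-1}) of the recurrence defining γ,
-- where s = (p-2)(q-2) - 2.  Induction on k then gives the closed forms.
module Submission where

open import Defs
open import Data.Nat using (ℕ; zero; suc; _≤_; _<_; _∸_; s≤s)
open import Data.Nat.Properties using (m≤n⇒∃[o]m+o≡n; *-identityˡ; *-identityʳ)
open import Data.Integer using (ℤ; +_; _+_; _-_; _*_)
open import Data.Integer.Properties using (*-zeroʳ; pos-*)
open import Data.Integer.Tactic.RingSolver using (solve-∀)
open import Data.List using (length; _++_)
open import Data.List.Properties using (length-++)
open import Data.Product using (_×_; _,_)
open import Data.Product.Properties using (×-≡,≡→≡; ×-≡,≡←≡)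
open import Relation.Binary.PropositionalEquality
  using (_≡_; refl; sym; trans; cong; cong₂; subst; module ≡-Reasoning)
import Data.Nat as ℕ

open ≡-Reasoning

len : Word → ℤ
len x = + length x

lengths : Word × Word → ℤ × ℤ
lengths (U , W) = len U , len W

len-++ : ∀ x y → len (x ++ y) ≡ len x + len y
len-++ x y = cong +_ (length-++ x)

length-^ʷ : ∀ x a → length (x ^ʷ a) ≡ a ℕ.* length x
length-^ʷ x zero    = refl
length-^ʷ x (suc a) = begin
  length (x ++ x ^ʷ a)               ≡⟨ length-++ x ⟩
  length x ℕ.+ length (x ^ʷ a)       ≡⟨ cong (length x ℕ.+_) (length-^ʷ x a) ⟩
  length x ℕ.+ a ℕ.* length x        ∎

len-^ʷ : ∀ x a → len (x ^ʷ a) ≡ + a * len x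
len-^ʷ x a = trans (cong +_ (length-^ʷ x a)) (pos-* a (length x))

len-++-^ʷ : ∀ x y a → len (x ++ y ^ʷ a) ≡ len x + + a * len y
len-++-^ʷ x y a = begin
  len (x ++ y ^ʷ a)       ≡⟨ len-++ x (y ^ʷ a) ⟩
  len x + len (y ^ʷ a)    ≡⟨ cong (_+_ (len x)) (len-^ʷ y a) ⟩
  len x + + a * len y     ∎

shortStep : ℕ → ℤ × ℤ → ℤ × ℤ
shortStep c (u , w) = w + + suc c * u , w + + c * u

longStep : ℕ → ℕ → ℤ × ℤ → ℤ × ℤ
longStep a b (u , w) = w + (+ a * u + + suc b * v) , w + (+ a * u + + b * v)
  where v = w + + suc a * u

lengths-short : ∀ c U W →
  lengths (W ++ U ^ʷ suc c , W ++ U ^ʷ c) ≡ shortStep c (lengths (U , W))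
lengths-short c U W = ×-≡,≡→≡ (len-++-^ʷ W U (suc c) , len-++-^ʷ W U c)

lengths-long : ∀ a b U W →
  lengths ( W ++ U ^ʷ a ++ (W ++ U ^ʷ suc a) ^ʷ suc b
          , W ++ U ^ʷ a ++ (W ++ U ^ʷ suc a) ^ʷ b)
    ≡ longStep a b (lengths (U , W))
lengths-long a b U W = ×-≡,≡→≡ (len-long (suc b) , len-long b)
  where
  len-long : ∀ e → len (W ++ U ^ʷ a ++ (W ++ U ^ʷ suc a) ^ʷ e)
                 ≡ len W + (+ a * len U + + e * (len W + + suc a * len U))
  len-long e = begin
    len (W ++ U ^ʷ a ++ (W ++ U ^ʷ suc a) ^ʷ e)
      ≡⟨ len-++ W _ ⟩
    len W + len (U ^ʷ a ++ (W ++ U ^ʷ suc a) ^ʷ e)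
      ≡⟨ cong (_+_ (len W)) (len-++ (U ^ʷ a) _) ⟩
    len W + (len (U ^ʷ a) + len ((W ++ U ^ʷ suc a) ^ʷ e))
      ≡⟨ cong (λ t → len W + (len (U ^ʷ a) + t)) (len-^ʷ (W ++ U ^ʷ suc a) e) ⟩
    len W + (len (U ^ʷ a) + + e * len (W ++ U ^ʷ suc a))
      ≡⟨ cong₂ (λ t r → len W + (t + + e * r)) (len-^ʷ U a) (len-++-^ʷ W U (suc a)) ⟩
    len W + (+ a * len U + + e * (len W + + suc a * len U))
      ∎

shift : ℤ → ℤ × ℤ → ℤ × ℤ
shift s (g₀ , g₁) = g₁ , s * g₁ - g₀

γ-pair : ℕ → ℕ → ℕ → ℤ × ℤ
γ-pair p q n = γℕ p q n , γℕ p q (suc n)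

lengths-UW : ∀ {p q} (M F : ℤ × ℤ → ℤ × ℤ) →
  (∀ x → lengths (step p q x) ≡ M (lengths x)) →
  (∀ g₀ g₁ → M (F (g₀ , g₁)) ≡ F (shift (sPar p q) (g₀ , g₁))) →
  lengths (base p q) ≡ F (+ 0 , + 1) →
  ∀ n → lengths (UW p q (suc n)) ≡ F (γ-pair p q n)
lengths-UW M F step-M M∘F base-F zero = base-F
lengths-UW {p} {q} M F step-M M∘F base-F (suc n) = begin
  lengths (step p q (UW p q (suc n)))  ≡⟨ step-M (UW p q (suc n)) ⟩
  M (lengths (UW p q (suc n)))         ≡⟨ cong M (lengths-UW M F step-M M∘F base-F n) ⟩
  M (F (γ-pair p q n))                 ≡⟨ M∘F (γℕ p q n) (γℕ p q (suc n)) ⟩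
  F (γ-pair p q (suc n))               ∎

γ-backward : ∀ p q n → γ p q (+ suc n - + 2) ≡ sPar p q * γℕ p q n - γℕ p q (suc n)
γ-backward p q zero    = sym (cong (_- + 1) (*-zeroʳ (sPar p q)))
γ-backward p q (suc n) = identity (sPar p q) (γℕ p q n) (γℕ p q (suc n))
  where
  identity : ∀ s g₀ g₁ → g₀ ≡ s * g₁ - (s * g₁ - g₀)
  identity = solve-∀

4<m∸2⇒7≤m : ∀ m → 4 < m ∸ 2 → 7 ≤ m
4<m∸2⇒7≤m (suc (suc m)) 4<m = s≤s (s≤s 4<m)

sPar-p≡3 : ∀ b → sPar 3 (7 ℕ.+ b) ≡ + 2 + + suc b
sPar-p≡3 b = identity (+ b)
  where
  identity : ∀ B → + 1 * (+ 5 + B) - + 2 ≡ + 2 + (+ 1 + B)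
  identity = solve-∀

sPar-q≡3 : ∀ a → sPar (7 ℕ.+ a) 3 ≡ + 2 + + suc a
sPar-q≡3 a = identity (+ a)
  where
  identity : ∀ A → (+ 5 + A) * + 1 - + 2 ≡ + 2 + (+ 1 + A)
  identity = solve-∀

closedForm-p≡3 : ℤ × ℤ → ℤ × ℤ
closedForm-p≡3 (g₀ , g₁) = g₁ , g₁ - g₀

closedForm-p,q≥4 : ℕ → ℤ × ℤ → ℤ × ℤ
closedForm-p,q≥4 a (g₀ , g₁) = g₁ + g₀ , g₁ - + suc a * g₀

-- s * g₀ - g₁ is the term preceding g₀, so this is (γ_k + γ_{k-1} , γ_k - γ_{k-2}).
closedForm-q≡3 : ℤ → ℤ × ℤ → ℤ × ℤ
closedForm-q≡3 s (g₀ , g₁) = g₁ + g₀ , g₁ - (s * g₀ - g₁)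

shortStep∘closedForm-p≡3 : ∀ c s → s ≡ + 2 + + c → ∀ g₀ g₁ →
  shortStep c (closedForm-p≡3 (g₀ , g₁)) ≡ closedForm-p≡3 (shift s (g₀ , g₁))
shortStep∘closedForm-p≡3 c _ refl g₀ g₁ = ×-≡,≡→≡ (u-identity (+ c) g₀ g₁ , w-identity (+ c) g₀ g₁)
  where
  u-identity : ∀ C g₀ g₁ → (g₁ - g₀) + (+ 1 + C) * g₁ ≡ (+ 2 + C) * g₁ - g₀
  u-identity = solve-∀
  w-identity : ∀ C g₀ g₁ → (g₁ - g₀) + C * g₁ ≡ ((+ 2 + C) * g₁ - g₀) - g₁
  w-identity = solve-∀

longStep∘closedForm-p,q≥4 : ∀ a b g₀ g₁ →
  longStep a b (closedForm-p,q≥4 a (g₀ , g₁))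
    ≡ closedForm-p,q≥4 a (shift ((+ 2 + + a) * (+ 2 + + b) - + 2) (g₀ , g₁))
longStep∘closedForm-p,q≥4 a b g₀ g₁ =
  ×-≡,≡→≡ (u-identity (+ a) (+ b) g₀ g₁ , w-identity (+ a) (+ b) g₀ g₁)
  where
  u-identity : ∀ A B g₀ g₁ →
    (g₁ - (+ 1 + A) * g₀) + (A * (g₁ + g₀) + (+ 1 + B) * ((g₁ - (+ 1 + A) * g₀) + (+ 1 + A) * (g₁ + g₀)))
      ≡ (((+ 2 + A) * (+ 2 + B) - + 2) * g₁ - g₀) + g₁
  u-identity = solve-∀
  w-identity : ∀ A B g₀ g₁ →
    (g₁ - (+ 1 + A) * g₀) + (A * (g₁ + g₀) + B * ((g₁ - (+ 1 + A) * g₀) + (+ 1 + A) * (g₁ + g₀)))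
      ≡ (((+ 2 + A) * (+ 2 + B) - + 2) * g₁ - g₀) - (+ 1 + A) * g₁
  w-identity = solve-∀

shortStep∘closedForm-q≡3 : ∀ c s → s ≡ + 2 + + c → ∀ g₀ g₁ →
  shortStep c (closedForm-q≡3 s (g₀ , g₁)) ≡ closedForm-q≡3 s (shift s (g₀ , g₁))
shortStep∘closedForm-q≡3 c _ refl g₀ g₁ = ×-≡,≡→≡ (u-identity (+ c) g₀ g₁ , w-identity (+ c) g₀ g₁)
  where
  u-identity : ∀ C g₀ g₁ →
    (g₁ - ((+ 2 + C) * g₀ - g₁)) + (+ 1 + C) * (g₁ + g₀) ≡ ((+ 2 + C) * g₁ - g₀) + g₁
  u-identity = solve-∀
  w-identity : ∀ C g₀ g₁ →
    (g₁ - ((+ 2 + C) * g₀ - g₁)) + C * (g₁ + g₀)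
      ≡ ((+ 2 + C) * g₁ - g₀) - ((+ 2 + C) * g₁ - ((+ 2 + C) * g₁ - g₀))
  w-identity = solve-∀

lengths-UW-p≡3 : ∀ b n → lengths (UW 3 (7 ℕ.+ b) (suc n)) ≡ closedForm-p≡3 (γ-pair 3 (7 ℕ.+ b) n)
lengths-UW-p≡3 b = lengths-UW (shortStep (suc b)) closedForm-p≡3
  (λ (U , W) → lengths-short (suc b) U W)
  (shortStep∘closedForm-p≡3 (suc b) _ (sPar-p≡3 b))
  refl

lengths-UW-p,q≥4 : ∀ a b n →
  lengths (UW (4 ℕ.+ a) (4 ℕ.+ b) (suc n)) ≡ closedForm-p,q≥4 a (γ-pair (4 ℕ.+ a) (4 ℕ.+ b) n)
lengths-UW-p,q≥4 a b = lengths-UW (longStep a b) (closedForm-p,q≥4 a)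
  (λ (U , W) → lengths-long a b U W)
  (longStep∘closedForm-p,q≥4 a b)
  (cong (λ t → + 1 , + 1 - t) (sym (*-zeroʳ (+ suc a))))

lengths-UW-q≡3 : ∀ a n →
  lengths (UW (7 ℕ.+ a) 3 (suc n)) ≡ closedForm-q≡3 (sPar (7 ℕ.+ a) 3) (γ-pair (7 ℕ.+ a) 3 n)
lengths-UW-q≡3 a = lengths-UW (shortStep (suc a)) (closedForm-q≡3 (sPar (7 ℕ.+ a) 3))
  (λ (U , W) → lengths-short (suc a) U W)
  (shortStep∘closedForm-q≡3 (suc a) _ (sPar-q≡3 a))
  (cong (λ t → + 1 , + 1 - (t - + 1)) (sym (*-zeroʳ (sPar (7 ℕ.+ a) 3))))

lemma5p1-p≡3 : ∀ p q → 4 < (p ∸ 2) ℕ.* (q ∸ 2) → ∀ n → p ≡ 3 →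
  (+ length (U p q (suc n)) ≡ γ p q (+ suc n))
  × (+ length (W p q (suc n)) ≡ γ p q (+ suc n) - γ p q (+ suc n - + 1))
lemma5p1-p≡3 .3 q 4<s n refl
  with b , refl ← m≤n⇒∃[o]m+o≡n (4<m∸2⇒7≤m q (subst (4 <_) (*-identityˡ (q ∸ 2)) 4<s))
  = ×-≡,≡←≡ (lengths-UW-p≡3 b n)

lemma5p1-p,q≥4 : ∀ p q n → 4 ≤ p → 4 ≤ q →
  (+ length (U p q (suc n)) ≡ γ p q (+ suc n) + γ p q (+ suc n - + 1))
  × (+ length (W p q (suc n)) ≡ γ p q (+ suc n) - (+ (p ∸ 3)) * γ p q (+ suc n - + 1))
lemma5p1-p,q≥4 p q n 4≤p 4≤q
  with a , refl ← m≤n⇒∃[o]m+o≡n 4≤p | b , refl ← m≤n⇒∃[o]m+o≡n 4≤q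
  = ×-≡,≡←≡ (lengths-UW-p,q≥4 a b n)

lemma5p1-q≡3 : ∀ p q → 4 < (p ∸ 2) ℕ.* (q ∸ 2) → ∀ n → q ≡ 3 →
  (+ length (U p q (suc n)) ≡ γ p q (+ suc n) + γ p q (+ suc n - + 1))
  × (+ length (W p q (suc n)) ≡ γ p q (+ suc n) - γ p q (+ suc n - + 2))
lemma5p1-q≡3 p .3 4<s n refl
  with a , refl ← m≤n⇒∃[o]m+o≡n (4<m∸2⇒7≤m p (subst (4 <_) (*-identityʳ (p ∸ 2)) 4<s))
  with u≡ , w≡ ← ×-≡,≡←≡ (lengths-UW-q≡3 a n)
  = u≡ , trans w≡ (cong (_-_ (γℕ p 3 (suc n))) (sym (γ-backward p 3 n)))

lemma5p1 : (p q : ℕ) → 3 ≤ p → 3 ≤ q → 4 < (p ∸ 2) Data.Nat.* (q ∸ 2) →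
    (k : ℕ) → 1 ≤ k →
      (p ≡ 3 →
        (+ length (U p q k) ≡ γ p q (+ k))
        × (+ length (W p q k) ≡ γ p q (+ k) - γ p q (+ k - + 1)))
      × (4 ≤ p → 4 ≤ q →
        (+ length (U p q k) ≡ γ p q (+ k) + γ p q (+ k - + 1))
        × (+ length (W p q k) ≡ γ p q (+ k) - (+ (p ∸ 3)) * γ p q (+ k - + 1)))
      × (q ≡ 3 →
        (+ length (U p q k) ≡ γ p q (+ k) + γ p q (+ k - + 1))
        × (+ length (W p q k) ≡ γ p q (+ k) - γ p q (+ k - + 2)))
lemma5p1 p q _ _ 4<s (suc n) _ =
  lemma5p1-p≡3 p q 4<s n , lemma5p1-p,q≥4 p q n , lemma5p1-q≡3 p q 4<s n
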